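{- Let $q>r\ge2$ and $g\ge3$ be integers, let $n\ge1$, let $Q$ be a $q$-clique of $K_n^r$, and let $J\subseteq K_n^r$. Then for every integer $s\ge1$, $$\left|{\rm Large}_J(Q)^{(s)}\right|\le (sq)\binom{sq}{r-1}\binom{sq}{q}^s n^{(q-r)(s-1)}\frac{\Delta(J)}{n}.$$
   Context: $K_n^r$ is the complete $r$-uniform hypergraph on $n$ vertices; a $q$-clique is a copy of $K_q^r$ in it, viewed as its edge set $\binom{V}{r}$ for a $q$-set $V$. A $(j,i)$-configuration is a set of $i$ $q$-cliques whose vertex sets have union of size at most $j$; for $i\ge3$, an $(i(q-r)+r,i)$ Erdős-configuration is an $(i(q-r)+r,i)$-configuration that contains no $(i'(q-r)+r,i')$-configuration for any $2\le i'<i$. ${\rm Girth}^g_{K_q^r}(K_n^r)$ is the hypergraph whose vertices are the $q$-cliques of $K_n^r$ and whose edges are the $(i(q-r)+r,i)$ Erdős-configurations for $3\le i\le g$. For an edge $F$ of this hypergraph, $V(F)$ is the union of the vertex sets of its cliques. An edge $F$ with $Q\in F$ is $(Q,J)$-large if some $r$-subset of $V(F)$ that is not an edge of $Q$ belongs to $J$; ${\rm Large}_J(Q)$ is the set of $(Q,J)$-large $F$, and ${\rm Large}_J(Q)^{(s)}$ those with $|F|=s$. $\Delta(J)$ is the maximum over $(r-1)$-sets $U$ of the number of edges of $J$ containing $U$. -}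

module Defs where

open import Data.Nat using (ℕ; zero; suc; _+_; _*_; _∸_; _^_; _≤_; _<_; _⊔_; _≤?_; _≟_)
open import Data.Nat.Combinatorics using (_C_)
open import Data.Bool using (Bool; true; false; _∧_; _∨_; not)
import Data.Bool as B
open import Data.List using (List; []; _∷_; _++_; map; length; filter; foldr)
open import Data.Bool.ListAction using (any)
open import Data.Vec using (Vec; []; _∷_)
open import Data.Vec.Properties using (≡-dec)
open import Data.Fin.Subset using (Subset; ∣_∣; _∪_; _⊆_; ⊥)
open import Data.Fin.Subset.Properties using (_⊆?_)
open import Relation.Nullary using (does)

subsets : (n : ℕ) → List (Subset n)
subsets zero = [] ∷ []
subsets (suc n) = map (false ∷_) (subsets n) ++ map (true ∷_) (subsets n)

sublists : {A : Set} → List A → List (List A)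
sublists [] = [] ∷ []
sublists (x ∷ xs) = sublists xs ++ map (x ∷_) (sublists xs)

-- The q-cliques of K_n^r, each identified with its vertex set (a q-subset of Fin n).
cliques : (n q : ℕ) → List (Subset n)
cliques n q = filter (λ V → ∣ V ∣ ≟ q) (subsets n)

_==_ : {n : ℕ} → Subset n → Subset n → Bool
A == B = does (≡-dec B._≟_ A B)

_⊆ᵇ_ : {n : ℕ} → Subset n → Subset n → Bool
A ⊆ᵇ B = does (A ⊆? B)

_≤ᵇ_ : ℕ → ℕ → Bool
a ≤ᵇ b = does (a ≤? b)

_==ℕ_ : ℕ → ℕ → Bool
a ==ℕ b = does (a ≟ b)

VF : {n : ℕ} → List (Subset n) → Subset n
VF = foldr _∪_ ⊥

isConfig : {n : ℕ} → ℕ → List (Subset n) → Bool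
isConfig j F = ∣ VF F ∣ ≤ᵇ j

isErdos : {n : ℕ} → (q r : ℕ) → List (Subset n) → Bool
isErdos q r F =
  isConfig (length F * (q ∸ r) + r) F ∧
  not (any (λ F' → (2 ≤ᵇ length F') ∧ (suc (length F') ≤ᵇ length F)
                   ∧ isConfig (length F' * (q ∸ r) + r) F')
           (sublists F))

isGirthEdge : {n : ℕ} → (q r g : ℕ) → List (Subset n) → Bool
isGirthEdge q r g F = (3 ≤ᵇ length F) ∧ (length F ≤ᵇ g) ∧ isErdos q r F

-- F is (Q,J)-large: Q ∈ F and some r-subset S of V(F) which is not an edge of Q
-- (i.e. S ⊄ Q) belongs to J.
isLarge : {n : ℕ} → (r : ℕ) → (J : Subset n → Bool) → Subset n → List (Subset n) → Bool
isLarge {n} r J Q F =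
  any (_== Q) F ∧
  any (λ S → (∣ S ∣ ==ℕ r) ∧ (S ⊆ᵇ VF F) ∧ not (S ⊆ᵇ Q) ∧ J S) (subsets n)

-- Large_J(Q)^{(s)}: the (Q,J)-large edges F of Girth^g with |F| = s.
-- Edges are sets of cliques, enumerated as sublists of the duplicate-free list of cliques.
LargeS : (n q r g : ℕ) → (J : Subset n → Bool) → Subset n → ℕ → List (List (Subset n))
LargeS n q r g J Q s =
  Data.List.filter (λ F → B.T? ((length F ==ℕ s) ∧ isGirthEdge q r g F ∧ isLarge r J Q F))
    (sublists (cliques n q))

Δ : (n r : ℕ) → (J : Subset n → Bool) → ℕ
Δ n r J = foldr _⊔_ 0
  (map (λ U → length (filter (λ S → B.T? (J S ∧ (U ⊆ᵇ S))) (subsets n)))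
       (filter (λ U → ∣ U ∣ ≟ (r ∸ 1)) (subsets n)))

{-# OPTIONS --safe #-}
-- A (Q,J)-large edge F with s cliques is determined by little data. Its vertex set
-- W = V(F) has at most s(q−r)+r ≤ sq vertices and contains Q together with a vertex
-- v ∉ Q of an edge S ∈ J with S ⊆ W. Hence W ∖ (Q ∪ {v}) has at most (q−r)(s−1)−1
-- vertices; listing them, padded with v, gives one of n^((q−r)(s−1)−1) tuples, and
-- X = Q ∪ {listed vertices} satisfies X ⊆ W ⊆ X ∪ {v}. Then S − v is an (r−1)-subset
-- of X, S is one of at most Δ(J) edges of J through it, W = X ∪ S, and F is an
-- s-tuple of q-subsets of W. So |Large| ≤ n^((q−r)(s−1)−1) C(sq,r−1) Δ(J) C(sq,q)^s;
-- as F has at least three cliques, (q−r)(s−1) ≥ 1, and multiplying by n gives the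
-- claim (the factor sq is slack).
module Submission where

open import Defs
open import Data.Nat using (ℕ; zero; suc; _+_; _*_; _∸_; _^_; _≤_; _<_; _⊔_; _≤′_; ≤′-refl; ≤′-step; _≟_; _≤?_; z≤n; s≤s)
open import Data.Nat.Properties
open import Data.Nat.Combinatorics using (_C_; nCk+nC[k+1]≡[n+1]C[k+1])
open import Data.Nat.Tactic.RingSolver using (solve-∀)
open import Data.Bool using (Bool; true; T; not; _∧_)
import Data.Bool as Bool
open import Data.Bool.Properties using (T-∧)
open import Data.Fin using (Fin; zero; suc)
import Data.Fin.Properties as Fin
open import Data.Fin.Subset
  using (Subset; inside; outside; ∣_∣; _∪_; _∩_; _─_; _-_; ⁅_⁆; ∁)
  renaming (_∈_ to _∈ₛ_; _∉_ to _∉ₛ_; _⊆_ to _⊆ₛ_; ⊥ to ∅)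
open import Data.Fin.Subset.Properties
  using ( _∈?_; _⊆?_; nonempty?; drop-∷-⊆; ∉⊥; x∈⁅x⁆; x∈⁅y⁆⇒x≡y; ∣⁅x⁆∣≡1; ⊆-trans; ⊆-antisym
        ; p⊆p∪q; q⊆p∪q; x∈p∪q⁺; x∈p∪q⁻; x∈p∩q⁺; x∈p∩q⁻; x∈∁p⇒x∉p; x∉∁p⇒x∈p
        ; p─q⊆p; x∈p∧x∉q⇒x∈p─q; x∈p∧x≢y⇒x∈p-y; p⊆q⇒∣p∣≤∣q∣ )
open import Data.List using (List; []; _∷_; _++_; map; length; filter; foldr; concatMap; replicate; allFin)
open import Data.List.Properties using (length-map; length-++; length-filter; length-replicate; length-tabulate; length-removeAt′)
import Data.List.Properties as List
open import Data.List.Membership.Propositional using (_∈_; lose; find)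
open import Data.List.Membership.Propositional.Properties
  using (∈-map⁺; ∈-map⁻; ∈-++⁺ˡ; ∈-++⁺ʳ; ∈-++⁻; ∈-concatMap⁺; ∈-filter⁺; ∈-filter⁻; ∈-allFin)
open import Data.List.Relation.Binary.Subset.Propositional using (_⊆_)
open import Data.List.Relation.Unary.Any using (here; there; index) renaming (_─_ to _∖_)
open import Data.Bool.ListAction using (any)
open import Data.List.Relation.Unary.Any.Properties using (any⁻)
open import Data.List.Relation.Unary.All using ([]; _∷_)
import Data.List.Relation.Unary.All as All
import Data.List.Relation.Unary.All.Properties as All
open import Data.List.Relation.Unary.AllPairs using ([]; _∷_)
open import Data.List.Relation.Unary.Unique.Propositional using (Unique)
import Data.List.Relation.Unary.Unique.Propositional.Properties as Unique
open import Data.Vec using ([]; _∷_; here; there)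
import Data.Vec.Properties as Vec
open import Data.Product using (∃; _×_; _,_; proj₂)
open import Data.Sum using (inj₁; inj₂)
open import Function using (_∘_; Equivalence)
open import Relation.Nullary using (¬_; Dec; yes; no; does; contradiction)
open import Relation.Nullary.Decidable using (T?)
open import Relation.Binary.PropositionalEquality using (_≡_; _≢_; refl; sym; trans; cong; cong₂; subst; ≢-sym; module ≡-Reasoning)

private
  variable
    A B : Set
    n : ℕ

T-does⁺ : (a? : Dec A) → A → T (does a?)
T-does⁺ (yes _) _ = _
T-does⁺ (no ¬a) a = ¬a a

T-does⁻ : (a? : Dec A) → T (does a?) → A
T-does⁻ (yes a) _ = a

T-not-does⁻ : (a? : Dec A) → T (not (does a?)) → ¬ A
T-not-does⁻ (no ¬a) _ = ¬a

T-∧⁻ : ∀ {a b} → T (a ∧ b) → T a × T b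
T-∧⁻ = Equivalence.to T-∧

T-∧⁻⁴ : ∀ {a b c d} → T (a ∧ b ∧ c ∧ d) → T a × T b × T c × T d
T-∧⁻⁴ abcd with a , bcd ← T-∧⁻ abcd with b , cd ← T-∧⁻ bcd = a , b , T-∧⁻ cd

∈-∖⁺ : {x y : A} {xs : List A} (x∈xs : x ∈ xs) → y ∈ xs → y ≢ x → y ∈ (xs ∖ x∈xs)
∈-∖⁺ (here refl) (here refl)  y≢x = contradiction refl y≢x
∈-∖⁺ (here refl) (there y∈xs) _   = y∈xs
∈-∖⁺ (there _)   (here refl)  _   = here refl
∈-∖⁺ (there x∈xs) (there y∈xs) y≢x = there (∈-∖⁺ x∈xs y∈xs y≢x)

Unique-⊆⇒length≤ : {xs ys : List A} → Unique xs → xs ⊆ ys → length xs ≤ length ys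
Unique-⊆⇒length≤ {xs = []} _ _ = z≤n
Unique-⊆⇒length≤ {xs = x ∷ xs} {ys} (x∉xs ∷ xs!) xs⊆ys = begin
  suc (length xs)          ≤⟨ s≤s (Unique-⊆⇒length≤ xs! xs⊆ys∖x) ⟩
  suc (length (ys ∖ x∈ys)) ≡⟨ length-removeAt′ ys (index x∈ys) ⟨
  length ys                ∎
  where
  open ≤-Reasoning
  x∈ys = xs⊆ys (here refl)
  xs⊆ys∖x : xs ⊆ (ys ∖ x∈ys)
  xs⊆ys∖x y∈xs = ∈-∖⁺ x∈ys (xs⊆ys (there y∈xs)) (≢-sym (All.lookup x∉xs y∈xs))

∈-concatMap⁺′ : (f : A → List B) {x : A} {xs : List A} {y : B} → x ∈ xs → y ∈ f x → y ∈ concatMap f xs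
∈-concatMap⁺′ f x∈xs y∈fx = ∈-concatMap⁺ f (lose x∈xs y∈fx)

length-concatMap≤ : (f : A → List B) {b : ℕ} (xs : List A) →
  (∀ {x} → x ∈ xs → length (f x) ≤ b) → length (concatMap f xs) ≤ length xs * b
length-concatMap≤ f []       _   = z≤n
length-concatMap≤ f {b} (x ∷ xs) f≤b = begin
  length (f x ++ concatMap f xs)         ≡⟨ length-++ (f x) ⟩
  length (f x) + length (concatMap f xs) ≤⟨ +-mono-≤ (f≤b (here refl)) (length-concatMap≤ f xs (f≤b ∘ there)) ⟩
  b + length xs * b                      ∎
  where open ≤-Reasoning

≤-foldr-⊔ : (f : A → ℕ) {x : A} {xs : List A} → x ∈ xs → f x ≤ foldr _⊔_ 0 (map f xs)
≤-foldr-⊔ f {xs = y ∷ _}  (here refl) = m≤m⊔n (f y) _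
≤-foldr-⊔ f {xs = y ∷ _}  (there x∈xs) = ≤-trans (≤-foldr-⊔ f x∈xs) (m≤n⊔m (f y) _)

length-*-≤-if-inhabited : (xs : List A) {P : Set} {k m : ℕ} →
  (∀ {x} → x ∈ xs → P) → (P → length xs * k ≤ m) → length xs * k ≤ m
length-*-≤-if-inhabited []      _      _ = z≤n
length-*-≤-if-inhabited (_ ∷ _) ∈xs⇒P P⇒ = P⇒ (∈xs⇒P (here refl))

tuples : ℕ → List A → List (List A)
tuples zero    xs = [] ∷ []
tuples (suc m) xs = concatMap (λ x → map (x ∷_) (tuples m xs)) xs

length-tuples≤ : ∀ m (xs : List A) → length (tuples m xs) ≤ length xs ^ m
length-tuples≤ zero    xs = ≤-refl
length-tuples≤ (suc m) xs = begin
  length (tuples (suc m) xs)       ≤⟨ length-concatMap≤ _ xs (λ {x} _ → ≤-reflexive (length-map (x ∷_) (tuples m xs))) ⟩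
  length xs * length (tuples m xs) ≤⟨ *-monoʳ-≤ (length xs) (length-tuples≤ m xs) ⟩
  length xs ^ suc m                ∎
  where open ≤-Reasoning

∈-tuples⁺ : ∀ {m} {xs ys : List A} → length ys ≡ m → ys ⊆ xs → ys ∈ tuples m xs
∈-tuples⁺ {ys = []}     refl _     = here refl
∈-tuples⁺ {ys = y ∷ ys} refl ys⊆xs =
  ∈-concatMap⁺′ _ (ys⊆xs (here refl)) (∈-map⁺ (y ∷_) (∈-tuples⁺ refl (λ x∈ys → ys⊆xs (there x∈ys))))

∈-sublists⇒⊆ : {xs ys : List A} → ys ∈ sublists xs → ys ⊆ xs
∈-sublists⇒⊆ {xs = []} (here refl) ()
∈-sublists⇒⊆ {xs = x ∷ xs} ys∈ y∈ys with ∈-++⁻ (sublists xs) ys∈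
... | inj₁ ys∈′ = there (∈-sublists⇒⊆ ys∈′ y∈ys)
... | inj₂ x∷ys∈ with ∈-map⁻ (x ∷_) x∷ys∈ | y∈ys
...   | _ , _    , refl | here refl = here refl
...   | _ , ys∈′ , refl | there y∈ys′ = there (∈-sublists⇒⊆ ys∈′ y∈ys′)

Unique-sublists : {xs : List A} → Unique xs → Unique (sublists xs)
Unique-sublists {xs = []} _ = [] ∷ []
Unique-sublists {xs = x ∷ xs} (x∉xs ∷ xs!) =
  Unique.++⁺ (Unique-sublists xs!) (Unique.map⁺ List.∷-injectiveʳ (Unique-sublists xs!)) disjoint
  where
  disjoint : ∀ {ys} → ¬ (ys ∈ sublists xs × ys ∈ map (x ∷_) (sublists xs))
  disjoint (ys∈ , ys∈x∷) with ∈-map⁻ (x ∷_) ys∈x∷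
  ... | _ , _ , refl = All.lookup x∉xs (∈-sublists⇒⊆ ys∈ (here refl)) refl

∈-subsets : (p : Subset n) → p ∈ subsets n
∈-subsets []            = here refl
∈-subsets (outside ∷ p) = ∈-++⁺ˡ (∈-map⁺ (outside ∷_) (∈-subsets p))
∈-subsets {suc n} (inside ∷ p) = ∈-++⁺ʳ (map (outside ∷_) (subsets n)) (∈-map⁺ (inside ∷_) (∈-subsets p))

Unique-subsets : ∀ n → Unique (subsets n)
Unique-subsets zero    = [] ∷ []
Unique-subsets (suc n) =
  Unique.++⁺ (Unique.map⁺ Vec.∷-injectiveʳ (Unique-subsets n)) (Unique.map⁺ Vec.∷-injectiveʳ (Unique-subsets n)) disjoint
  where
  disjoint : ∀ {p} → ¬ (p ∈ map (outside ∷_) (subsets n) × p ∈ map (inside ∷_) (subsets n))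
  disjoint (p∈out , p∈in) with ∈-map⁻ (outside ∷_) p∈out | ∈-map⁻ (inside ∷_) p∈in
  ... | _ , _ , refl | _ , _ , ()

nCk≤[1+n]Ck : ∀ m k → m C k ≤ suc m C k
nCk≤[1+n]Ck m zero    = ≤-refl
nCk≤[1+n]Ck m (suc k) = subst (m C suc k ≤_) (nCk+nC[k+1]≡[n+1]C[k+1] m k) (m≤n+m _ _)

C-monoˡ-≤ : ∀ k {m m′} → m ≤ m′ → m C k ≤ m′ C k
C-monoˡ-≤ k {m} m≤m′ = go (≤⇒≤′ m≤m′)
  where
  go : ∀ {m′} → m ≤′ m′ → m C k ≤ m′ C k
  go ≤′-refl       = ≤-refl
  go (≤′-step m≤′) = ≤-trans (go m≤′) (nCk≤[1+n]Ck _ k)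

subsetsOfSize : ℕ → Subset n → List (Subset n)
subsetsOfSize k       (outside ∷ p) = map (outside ∷_) (subsetsOfSize k p)
subsetsOfSize zero    (inside ∷ p)  = map (outside ∷_) (subsetsOfSize zero p)
subsetsOfSize (suc k) (inside ∷ p)  =
  map (outside ∷_) (subsetsOfSize (suc k) p) ++ map (inside ∷_) (subsetsOfSize k p)
subsetsOfSize zero    []            = [] ∷ []
subsetsOfSize (suc k) []            = []

length-subsetsOfSize : ∀ k (p : Subset n) → length (subsetsOfSize k p) ≡ ∣ p ∣ C k
length-subsetsOfSize k       (outside ∷ p) = trans (length-map _ (subsetsOfSize k p)) (length-subsetsOfSize k p)
length-subsetsOfSize zero    (inside ∷ p)  = trans (length-map _ (subsetsOfSize zero p)) (length-subsetsOfSize zero p)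
length-subsetsOfSize (suc k) (inside ∷ p)  = begin
  length (map (outside ∷_) (subsetsOfSize (suc k) p) ++ map (inside ∷_) (subsetsOfSize k p))
    ≡⟨ length-++ (map (outside ∷_) (subsetsOfSize (suc k) p)) ⟩
  length (map (outside ∷_) (subsetsOfSize (suc k) p)) + length (map (inside ∷_) (subsetsOfSize k p))
    ≡⟨ cong₂ _+_ (length-map _ (subsetsOfSize (suc k) p)) (length-map _ (subsetsOfSize k p)) ⟩
  length (subsetsOfSize (suc k) p) + length (subsetsOfSize k p)
    ≡⟨ cong₂ _+_ (length-subsetsOfSize (suc k) p) (length-subsetsOfSize k p) ⟩
  ∣ p ∣ C suc k + ∣ p ∣ C k
    ≡⟨ +-comm (∣ p ∣ C suc k) (∣ p ∣ C k) ⟩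
  ∣ p ∣ C k + ∣ p ∣ C suc k
    ≡⟨ nCk+nC[k+1]≡[n+1]C[k+1] ∣ p ∣ k ⟩
  suc ∣ p ∣ C suc k ∎
  where open ≡-Reasoning
length-subsetsOfSize zero    []            = refl
length-subsetsOfSize (suc k) []            = refl

length-subsetsOfSize≤ : ∀ k (p : Subset n) {m} → ∣ p ∣ ≤ m → length (subsetsOfSize k p) ≤ m C k
length-subsetsOfSize≤ k p ∣p∣≤m = subst (_≤ _) (sym (length-subsetsOfSize k p)) (C-monoˡ-≤ k ∣p∣≤m)

∈-subsetsOfSize⁺ : {p q : Subset n} → q ⊆ₛ p → q ∈ subsetsOfSize ∣ q ∣ p
∈-subsetsOfSize⁺ {p = []}          {[]}          _   = here refl
∈-subsetsOfSize⁺ {p = outside ∷ p} {outside ∷ q} q⊆p = ∈-map⁺ (outside ∷_) (∈-subsetsOfSize⁺ (drop-∷-⊆ q⊆p))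
∈-subsetsOfSize⁺ {p = outside ∷ p} {inside ∷ q}  q⊆p with q⊆p here
... | ()
∈-subsetsOfSize⁺ {p = inside ∷ p}  {outside ∷ q} q⊆p with ∣ q ∣ | ∈-subsetsOfSize⁺ {p = p} (drop-∷-⊆ q⊆p)
... | zero  | q∈ = ∈-map⁺ (outside ∷_) q∈
... | suc k | q∈ = ∈-++⁺ˡ (∈-map⁺ (outside ∷_) q∈)
∈-subsetsOfSize⁺ {p = inside ∷ p}  {inside ∷ q}  q⊆p =
  ∈-++⁺ʳ (map (outside ∷_) (subsetsOfSize (suc ∣ q ∣) p)) (∈-map⁺ (inside ∷_) (∈-subsetsOfSize⁺ (drop-∷-⊆ q⊆p)))

∈-subsetsOfSize⁻ : ∀ {k} {p q : Subset n} → q ∈ subsetsOfSize k p → ∣ q ∣ ≡ k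
∈-subsetsOfSize⁻ {k = zero}  {[]}          (here refl) = refl
∈-subsetsOfSize⁻ {k = k}     {outside ∷ p} q∈ with ∈-map⁻ (outside ∷_) q∈
... | _ , q′∈ , refl = ∈-subsetsOfSize⁻ {p = p} q′∈
∈-subsetsOfSize⁻ {k = zero}  {inside ∷ p}  q∈ with ∈-map⁻ (outside ∷_) q∈
... | _ , q′∈ , refl = ∈-subsetsOfSize⁻ {p = p} q′∈
∈-subsetsOfSize⁻ {k = suc k} {inside ∷ p}  q∈ with ∈-++⁻ (map (outside ∷_) (subsetsOfSize (suc k) p)) q∈
... | inj₁ q∈out with ∈-map⁻ (outside ∷_) q∈out
...   | _ , q′∈ , refl = ∈-subsetsOfSize⁻ {p = p} q′∈
∈-subsetsOfSize⁻ {k = suc k} {inside ∷ p}  q∈ | inj₂ q∈in with ∈-map⁻ (inside ∷_) q∈in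
...   | _ , q′∈ , refl = cong suc (∈-subsetsOfSize⁻ {p = p} q′∈)

p⊆r∧q⊆r⇒p∪q⊆r : {p q r : Subset n} → p ⊆ₛ r → q ⊆ₛ r → p ∪ q ⊆ₛ r
p⊆r∧q⊆r⇒p∪q⊆r {p = p} {q} p⊆r q⊆r x∈p∪q with x∈p∪q⁻ p q x∈p∪q
... | inj₁ x∈p = p⊆r x∈p
... | inj₂ x∈q = q⊆r x∈q

x∈p─q⁻ : ∀ (p q : Subset n) {x} → x ∈ₛ p ─ q → x ∈ₛ p × x ∉ₛ q
x∈p─q⁻ p q x∈p─q = p─q⊆p p q x∈p─q , ∉q p q x∈p─q
  where
  ∉q : ∀ {n} (p q : Subset n) {x} → x ∈ₛ p ─ q → x ∉ₛ q
  ∉q (_ ∷ p) (_ ∷ q) (there x∈) (there x∈q) = ∉q p q x∈ x∈q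

∣p─q∣+∣q∣≡∣p∣ : {p q : Subset n} → q ⊆ₛ p → ∣ p ─ q ∣ + ∣ q ∣ ≡ ∣ p ∣
∣p─q∣+∣q∣≡∣p∣ {p = []}          {[]}          _   = refl
∣p─q∣+∣q∣≡∣p∣ {p = outside ∷ p} {outside ∷ q} q⊆p = ∣p─q∣+∣q∣≡∣p∣ (drop-∷-⊆ q⊆p)
∣p─q∣+∣q∣≡∣p∣ {p = outside ∷ p} {inside ∷ q}  q⊆p with q⊆p here
... | ()
∣p─q∣+∣q∣≡∣p∣ {p = inside ∷ p}  {outside ∷ q} q⊆p = cong suc (∣p─q∣+∣q∣≡∣p∣ (drop-∷-⊆ q⊆p))
∣p─q∣+∣q∣≡∣p∣ {p = inside ∷ p}  {inside ∷ q}  q⊆p =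
  trans (+-suc ∣ p ─ q ∣ ∣ q ∣) (cong suc (∣p─q∣+∣q∣≡∣p∣ (drop-∷-⊆ q⊆p)))

x∈p⇒suc∣p-x∣≡∣p∣ : {p : Subset n} {x : Fin n} → x ∈ₛ p → suc ∣ p - x ∣ ≡ ∣ p ∣
x∈p⇒suc∣p-x∣≡∣p∣ {p = p} {x} x∈p = begin
  suc ∣ p - x ∣       ≡⟨ +-comm 1 ∣ p - x ∣ ⟩
  ∣ p - x ∣ + 1       ≡⟨ cong (∣ p - x ∣ +_) (∣⁅x⁆∣≡1 x) ⟨
  ∣ p - x ∣ + ∣ ⁅ x ⁆ ∣ ≡⟨ ∣p─q∣+∣q∣≡∣p∣ ⁅x⁆⊆p ⟩
  ∣ p ∣               ∎
  where
  open ≡-Reasoning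
  ⁅x⁆⊆p : ⁅ x ⁆ ⊆ₛ p
  ⁅x⁆⊆p y∈⁅x⁆ = subst (_∈ₛ p) (sym (x∈⁅y⁆⇒x≡y x y∈⁅x⁆)) x∈p

p─q-x⊆r⇒p⊆q∪r∪⁅x⁆ : {p q r : Subset n} {x : Fin n} → (p ─ q) - x ⊆ₛ r → p ⊆ₛ (q ∪ r) ∪ ⁅ x ⁆
p─q-x⊆r⇒p⊆q∪r∪⁅x⁆ {q = q} {x = x} p─q-x⊆r {y} y∈p with y ∈? q | y Fin.≟ x
... | yes y∈q | _        = x∈p∪q⁺ (inj₁ (x∈p∪q⁺ (inj₁ y∈q)))
... | no  _   | yes refl = x∈p∪q⁺ (inj₂ (x∈⁅x⁆ x))
... | no  y∉q | no  y≢x  =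
  x∈p∪q⁺ (inj₁ (x∈p∪q⁺ (inj₂ (p─q-x⊆r (x∈p∧x≢y⇒x∈p-y (x∈p∧x∉q⇒x∈p─q y∈p y∉q) y≢x)))))

p⊆q∪⁅x⁆⇒p-x⊆q : {p q : Subset n} {x : Fin n} → p ⊆ₛ q ∪ ⁅ x ⁆ → p - x ⊆ₛ q
p⊆q∪⁅x⁆⇒p-x⊆q {p = p} {q} {x} p⊆q∪⁅x⁆ y∈p-x with y∈p , y∉⁅x⁆ ← x∈p─q⁻ p ⁅ x ⁆ y∈p-x
  with x∈p∪q⁻ q ⁅ x ⁆ (p⊆q∪⁅x⁆ y∈p)
... | inj₁ y∈q   = y∈q
... | inj₂ y∈⁅x⁆ = contradiction y∈⁅x⁆ y∉⁅x⁆

p⊈q⇒∃∈p∉q : {p q : Subset n} → ¬ (p ⊆ₛ q) → ∃ λ x → x ∈ₛ p × x ∉ₛ q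
p⊈q⇒∃∈p∉q {p = p} {q} p⊈q with nonempty? (p ∩ ∁ q)
... | yes (x , x∈p∩∁q) = let x∈p , x∈∁q = x∈p∩q⁻ p (∁ q) x∈p∩∁q in x , x∈p , x∈∁p⇒x∉p x∈∁q
... | no  p∩∁q-empty  = contradiction (λ {x} x∈p → x∉∁p⇒x∈p (λ x∈∁q → p∩∁q-empty (_ , x∈p∩q⁺ (x∈p , x∈∁q)))) p⊈q

p∈ps⇒p⊆VF : {p : Subset n} {ps : List (Subset n)} → p ∈ ps → p ⊆ₛ VF ps
p∈ps⇒p⊆VF {ps = p ∷ ps} (here refl)  = p⊆p∪q (VF ps)
p∈ps⇒p⊆VF {ps = q ∷ ps} (there p∈ps) = ⊆-trans (p∈ps⇒p⊆VF p∈ps) (q⊆p∪q q (VF ps))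

elements : Subset n → List (Fin n)
elements []            = []
elements (inside ∷ p)  = zero ∷ map suc (elements p)
elements (outside ∷ p) = map suc (elements p)

length-elements : (p : Subset n) → length (elements p) ≡ ∣ p ∣
length-elements []            = refl
length-elements (inside ∷ p)  = cong suc (trans (length-map suc (elements p)) (length-elements p))
length-elements (outside ∷ p) = trans (length-map suc (elements p)) (length-elements p)

∈-elements⁺ : {p : Subset n} {x : Fin n} → x ∈ₛ p → x ∈ elements p
∈-elements⁺ {p = inside ∷ p}  here       = here refl
∈-elements⁺ {p = inside ∷ p}  (there x∈) = there (∈-map⁺ suc (∈-elements⁺ x∈))
∈-elements⁺ {p = outside ∷ p} (there x∈) = ∈-map⁺ suc (∈-elements⁺ x∈)

∈-elements⁻ : (p : Subset n) {x : Fin n} → x ∈ elements p → x ∈ₛ p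
∈-elements⁻ (inside ∷ p)  (here refl) = here
∈-elements⁻ (inside ∷ p)  (there x∈) with ∈-map⁻ suc x∈
... | _ , y∈ , refl = there (∈-elements⁻ p y∈)
∈-elements⁻ (outside ∷ p) x∈ with ∈-map⁻ suc x∈
... | _ , y∈ , refl = there (∈-elements⁻ p y∈)

fromList : List (Fin n) → Subset n
fromList = foldr (λ x p → ⁅ x ⁆ ∪ p) ∅

∈-fromList⁺ : {xs : List (Fin n)} {x : Fin n} → x ∈ xs → x ∈ₛ fromList xs
∈-fromList⁺ {xs = x ∷ _} (here refl) = x∈p∪q⁺ (inj₁ (x∈⁅x⁆ x))
∈-fromList⁺ (there x∈xs) = x∈p∪q⁺ (inj₂ (∈-fromList⁺ x∈xs))

∈-fromList⁻ : (xs : List (Fin n)) {x : Fin n} → x ∈ₛ fromList xs → x ∈ xs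
∈-fromList⁻ []       x∈ = contradiction x∈ ∉⊥
∈-fromList⁻ (y ∷ xs) x∈ with x∈p∪q⁻ ⁅ y ⁆ (fromList xs) x∈
... | inj₁ x∈⁅y⁆ = here (x∈⁅y⁆⇒x≡y y x∈⁅y⁆)
... | inj₂ x∈xs  = there (∈-fromList⁻ xs x∈xs)

padded-elements : (p : Subset n) (x : Fin n) {k : ℕ} → ∣ p ∣ ≤ k →
  ∃ λ xs → length xs ≡ k × p ⊆ₛ fromList xs × fromList xs ⊆ₛ p ∪ ⁅ x ⁆
padded-elements p x {k} ∣p∣≤k = xs , length-xs , p⊆xs , xs⊆p∪x
  where
  open ≡-Reasoning
  xs = elements p ++ replicate (k ∸ ∣ p ∣) x
  length-xs : length xs ≡ k
  length-xs = begin
    length xs                                                ≡⟨ length-++ (elements p) ⟩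
    length (elements p) + length (replicate (k ∸ ∣ p ∣) x) ≡⟨ cong₂ _+_ (length-elements p) (length-replicate _) ⟩
    ∣ p ∣ + (k ∸ ∣ p ∣)                                      ≡⟨ m+[n∸m]≡n ∣p∣≤k ⟩
    k                                                        ∎
  p⊆xs : p ⊆ₛ fromList xs
  p⊆xs y∈p = ∈-fromList⁺ (∈-++⁺ˡ (∈-elements⁺ y∈p))
  xs⊆p∪x : fromList xs ⊆ₛ p ∪ ⁅ x ⁆
  xs⊆p∪x y∈xs with ∈-++⁻ (elements p) (∈-fromList⁻ xs y∈xs)
  ... | inj₁ y∈p = x∈p∪q⁺ (inj₁ (∈-elements⁻ p y∈p))
  ... | inj₂ y∈x = x∈p∪q⁺ (inj₂ (subst (_∈ₛ ⁅ x ⁆) (sym (All.lookup (All.replicate⁺ {P = _≡ x} _ refl) y∈x)) (x∈⁅x⁆ x)))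

-- |V(F)| ≤ s(q−r)+r, of which q vertices lie in Q and one more is the vertex v.
padding : ℕ → ℕ → ℕ → ℕ
padding q r s = (q ∸ r) * (s ∸ 1) ∸ 1

sparse-size : ∀ {s q r} → 1 ≤ s → r ≤ q → s * (q ∸ r) + r ≡ q + (q ∸ r) * (s ∸ 1)
sparse-size {suc s} {q} {r} _ r≤q = begin
  suc s * (q ∸ r) + r       ≡⟨ rearrange (q ∸ r) s r ⟩
  q ∸ r + r + (q ∸ r) * s   ≡⟨ cong (_+ (q ∸ r) * s) (m∸n+n≡m r≤q) ⟩
  q + (q ∸ r) * s           ∎
  where
  open ≡-Reasoning
  rearrange : ∀ d s r → suc s * d + r ≡ d + r + d * s
  rearrange = solve-∀

sparse-size≤ : ∀ {s q r} → 1 ≤ s → r ≤ q → s * (q ∸ r) + r ≤ s * q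
sparse-size≤ {suc s} {q} {r} 1≤s r≤q = begin
  suc s * (q ∸ r) + r  ≡⟨ sparse-size 1≤s r≤q ⟩
  q + (q ∸ r) * s      ≤⟨ +-monoʳ-≤ q (*-monoˡ-≤ s (m∸n≤m q r)) ⟩
  q + q * s            ≡⟨ cong (q +_) (*-comm q s) ⟩
  suc s * q            ∎
  where open ≤-Reasoning

padding-bound : ∀ {s q r a} → 1 ≤ s → r ≤ q → suc a + q ≤ s * (q ∸ r) + r → a ≤ padding q r s
padding-bound {s} {q} {r} {a} 1≤s r≤q a+1+q≤ = ∸-monoˡ-≤ 1 (+-cancelˡ-≤ q _ _ (begin
  q + suc a                ≡⟨ +-comm q (suc a) ⟩
  suc a + q                ≤⟨ a+1+q≤ ⟩
  s * (q ∸ r) + r          ≡⟨ sparse-size 1≤s r≤q ⟩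
  q + (q ∸ r) * (s ∸ 1)    ∎))
  where open ≤-Reasoning

∣W─Q-v∣≤padding : ∀ {q r s} {W Q : Subset n} {v : Fin n} → ∣ Q ∣ ≡ q → r ≤ q → 1 ≤ s →
  Q ⊆ₛ W → v ∈ₛ W → v ∉ₛ Q → ∣ W ∣ ≤ s * (q ∸ r) + r → ∣ (W ─ Q) - v ∣ ≤ padding q r s
∣W─Q-v∣≤padding {q = q} {r} {s} {W} {Q} {v} ∣Q∣≡q r≤q 1≤s Q⊆W v∈W v∉Q ∣W∣≤ = padding-bound 1≤s r≤q (begin
  suc ∣ (W ─ Q) - v ∣ + q  ≡⟨ cong₂ _+_ (x∈p⇒suc∣p-x∣≡∣p∣ (x∈p∧x∉q⇒x∈p─q v∈W v∉Q)) (sym ∣Q∣≡q) ⟩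
  ∣ W ─ Q ∣ + ∣ Q ∣         ≡⟨ ∣p─q∣+∣q∣≡∣p∣ Q⊆W ⟩
  ∣ W ∣                    ≤⟨ ∣W∣≤ ⟩
  s * (q ∸ r) + r          ∎)
  where open ≤-Reasoning

rescale-bound : ∀ {L n k a b c m} → 1 ≤ k → 1 ≤ m →
  L ≤ n ^ (k ∸ 1) * (a * b) * c → L * n ≤ m * a * c * n ^ k * b
rescale-bound {L} {n} {suc k} {a} {b} {c} {m} _ 1≤m L≤ = begin
  L * n                           ≤⟨ *-monoˡ-≤ n L≤ ⟩
  n ^ k * (a * b) * c * n         ≡⟨ rearrange (n ^ k) n a b c ⟩
  1 * (a * c * n ^ suc k * b)     ≤⟨ *-monoˡ-≤ (a * c * n ^ suc k * b) 1≤m ⟩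
  m * (a * c * n ^ suc k * b)     ≡⟨ reassociate m a c (n ^ suc k) b ⟩
  m * a * c * n ^ suc k * b       ∎
  where
  open ≤-Reasoning
  rearrange : ∀ x n a b c → x * (a * b) * c * n ≡ 1 * (a * c * (n * x) * b)
  rearrange = solve-∀
  reassociate : ∀ m a c x b → m * (a * c * x * b) ≡ m * a * c * x * b
  reassociate = solve-∀

edgesThrough : (J : Subset n → Bool) → Subset n → List (Subset n)
edgesThrough {n} J U = filter (λ S → T? (J S ∧ (U ⊆ᵇ S))) (subsets n)

length-edgesThrough≤Δ : ∀ r (J : Subset n → Bool) (U : Subset n) → ∣ U ∣ ≡ r ∸ 1 →
  length (edgesThrough J U) ≤ Δ n r J
length-edgesThrough≤Δ r J U ∣U∣≡ =
  ≤-foldr-⊔ (λ U → length (edgesThrough J U)) (∈-filter⁺ (λ U → ∣ U ∣ ≟ r ∸ 1) (∈-subsets U) ∣U∣≡)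

record LargeEdge {n : ℕ} (q r : ℕ) (J : Subset n → Bool) (Q : Subset n) (F : List (Subset n)) : Set where
  field
    clique-size : ∀ {D} → D ∈ F → ∣ D ∣ ≡ q
    three≤size  : 3 ≤ length F
    sparse      : ∣ VF F ∣ ≤ length F * (q ∸ r) + r
    Q⊆VF        : Q ⊆ₛ VF F
    edge        : Subset n
    ∣edge∣≡r    : ∣ edge ∣ ≡ r
    edge⊆VF     : edge ⊆ₛ VF F
    edge⊈Q      : ¬ edge ⊆ₛ Q
    edge∈J      : T (J edge)

open LargeEdge

isGirthEdge⇒ : ∀ {n} q r g (F : List (Subset n)) → T (isGirthEdge q r g F) →
  3 ≤ length F × ∣ VF F ∣ ≤ length F * (q ∸ r) + r
isGirthEdge⇒ q r g F girth
  with three≤ , rest ← T-∧⁻ {3 ≤ᵇ length F} girth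
  with _ , erdos     ← T-∧⁻ {length F ≤ᵇ g} rest
  with sparse , _    ← T-∧⁻ {isConfig (length F * (q ∸ r) + r) F} erdos
  = T-does⁻ (3 ≤? length F) three≤ , T-does⁻ (∣ VF F ∣ ≤? length F * (q ∸ r) + r) sparse

∈LargeS⇒ : ∀ {n q r g J Q s F} → F ∈ LargeS n q r g J Q s → length F ≡ s × LargeEdge q r J Q F
∈LargeS⇒ {n} {q} {r} {g} {J} {Q} {s} {F} F∈
  with F∈sublists , holds      ← ∈-filter⁻ _ {xs = sublists (cliques n q)} F∈
  with size≡s , girth∧large    ← T-∧⁻ {length F ==ℕ s} holds
  with girth , large           ← T-∧⁻ {isGirthEdge q r g F} girth∧large
  with three≤ , sparse         ← isGirthEdge⇒ q r g F girth
  with Q∈F , edge∈             ← T-∧⁻ {any (_== Q) F} large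
  with Q′ , Q′∈F , Q′≡Q        ← find (any⁻ _ F Q∈F)
  with S , _ , S-props         ← find (any⁻ _ (subsets n) edge∈)
  with ∣S∣≡r , S⊆VF , S⊈Q , S∈J ← T-∧⁻⁴ {∣ S ∣ ==ℕ r} {S ⊆ᵇ VF F} {not (S ⊆ᵇ Q)} S-props
  = T-does⁻ (length F ≟ s) size≡s , record
    { clique-size = λ D∈F → proj₂ (∈-filter⁻ (λ V → ∣ V ∣ ≟ q) {xs = subsets n} (∈-sublists⇒⊆ F∈sublists D∈F))
    ; three≤size  = three≤
    ; sparse      = sparse
    ; Q⊆VF        = subst (_⊆ₛ VF F) (T-does⁻ (Vec.≡-dec Bool._≟_ Q′ Q) Q′≡Q) (p∈ps⇒p⊆VF Q′∈F)
    ; edge        = S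
    ; ∣edge∣≡r    = T-does⁻ (∣ S ∣ ≟ r) ∣S∣≡r
    ; edge⊆VF     = T-does⁻ (S ⊆? VF F) S⊆VF
    ; edge⊈Q      = T-not-does⁻ (S ⊆? Q) S⊈Q
    ; edge∈J      = S∈J
    }

∈LargeS⇒3≤s : ∀ {n q r g J Q s F} → F ∈ LargeS n q r g J Q s → 3 ≤ s
∈LargeS⇒3≤s F∈ = let size≡s , large = ∈LargeS⇒ F∈ in subst (3 ≤_) size≡s (three≤size large)

Unique-LargeS : ∀ n q r g J (Q : Subset n) s → Unique (LargeS n q r g J Q s)
Unique-LargeS n q r g J Q s = Unique.filter⁺ _ (Unique-sublists (Unique.filter⁺ _ (Unique-subsets n)))

module Encoding {n : ℕ} (q r s : ℕ) (Q : Subset n) (J : Subset n → Bool) where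

  small : List (Subset n) → List (Subset n)
  small = filter (λ W → ∣ W ∣ ≤? s * q)

  ∈-small⁻ : ∀ Ws {W} → W ∈ small Ws → ∣ W ∣ ≤ s * q
  ∈-small⁻ Ws W∈ = proj₂ (∈-filter⁻ (λ W → ∣ W ∣ ≤? s * q) {xs = Ws} W∈)

  length-small≤ : ∀ Ws → length (small Ws) ≤ length Ws
  length-small≤ = length-filter (λ W → ∣ W ∣ ≤? s * q)

  ∈-small⁺ : ∀ {Ws W} → W ∈ Ws → ∣ W ∣ ≤ s * q → W ∈ small Ws
  ∈-small⁺ = ∈-filter⁺ (λ W → ∣ W ∣ ≤? s * q)

  hull : List (Fin n) → Subset n
  hull xs = Q ∪ fromList xs

  hulls : List (Subset n)
  hulls = small (map hull (tuples (padding q r s) (allFin n)))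

  ∈-hulls⁻ : ∀ {X} → X ∈ hulls → ∣ X ∣ ≤ s * q
  ∈-hulls⁻ = ∈-small⁻ (map hull (tuples (padding q r s) (allFin n)))

  extensions : Subset n → List (Subset n)
  extensions X = concatMap (λ U → map (X ∪_) (edgesThrough J U)) (subsetsOfSize (r ∸ 1) X)

  vertexSets : List (Subset n)
  vertexSets = small (concatMap extensions hulls)

  ∈-vertexSets⁻ : ∀ {W} → W ∈ vertexSets → ∣ W ∣ ≤ s * q
  ∈-vertexSets⁻ = ∈-small⁻ (concatMap extensions hulls)

  candidates : List (List (Subset n))
  candidates = concatMap (λ W → tuples s (subsetsOfSize q W)) vertexSets

  length-hulls≤ : length hulls ≤ n ^ padding q r s
  length-hulls≤ = begin
    length hulls                                     ≤⟨ length-small≤ (map hull (tuples (padding q r s) (allFin n))) ⟩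
    length (map hull (tuples (padding q r s) (allFin n))) ≡⟨ length-map hull (tuples (padding q r s) (allFin n)) ⟩
    length (tuples (padding q r s) (allFin n))       ≤⟨ length-tuples≤ (padding q r s) (allFin n) ⟩
    length (allFin n) ^ padding q r s                ≡⟨ cong (_^ padding q r s) (length-tabulate _) ⟩
    n ^ padding q r s                                ∎
    where open ≤-Reasoning

  length-extensions≤ : ∀ {X} → ∣ X ∣ ≤ s * q → length (extensions X) ≤ ((s * q) C (r ∸ 1)) * Δ n r J
  length-extensions≤ {X} ∣X∣≤ = begin
    length (extensions X)                      ≤⟨ length-concatMap≤ _ _ edgesThrough≤Δ ⟩
    length (subsetsOfSize (r ∸ 1) X) * Δ n r J ≤⟨ *-monoˡ-≤ (Δ n r J) (length-subsetsOfSize≤ (r ∸ 1) X ∣X∣≤) ⟩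
    ((s * q) C (r ∸ 1)) * Δ n r J                ∎
    where
    open ≤-Reasoning
    edgesThrough≤Δ : ∀ {U} → U ∈ subsetsOfSize (r ∸ 1) X → length (map (X ∪_) (edgesThrough J U)) ≤ Δ n r J
    edgesThrough≤Δ {U} U∈ = ≤-trans (≤-reflexive (length-map (X ∪_) (edgesThrough J U)))
                                    (length-edgesThrough≤Δ r J U (∈-subsetsOfSize⁻ {p = X} U∈))

  length-candidates≤ : length candidates ≤ n ^ padding q r s * (((s * q) C (r ∸ 1)) * Δ n r J) * ((s * q) C q) ^ s
  length-candidates≤ = begin
    length candidates                      ≤⟨ length-concatMap≤ _ vertexSets tuples≤ ⟩
    length vertexSets * ((s * q) C q) ^ s  ≤⟨ *-monoˡ-≤ _ (length-small≤ (concatMap extensions hulls)) ⟩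
    length (concatMap extensions hulls) * ((s * q) C q) ^ s
      ≤⟨ *-monoˡ-≤ _ (length-concatMap≤ extensions hulls (λ {X} X∈ → length-extensions≤ {X} (∈-hulls⁻ X∈))) ⟩
    length hulls * (((s * q) C (r ∸ 1)) * Δ n r J) * ((s * q) C q) ^ s
      ≤⟨ *-monoˡ-≤ _ (*-monoˡ-≤ _ length-hulls≤) ⟩
    n ^ padding q r s * (((s * q) C (r ∸ 1)) * Δ n r J) * ((s * q) C q) ^ s ∎
    where
    open ≤-Reasoning
    tuples≤ : ∀ {W} → W ∈ vertexSets → length (tuples s (subsetsOfSize q W)) ≤ ((s * q) C q) ^ s
    tuples≤ {W} W∈ = ≤-trans (length-tuples≤ s _) (^-monoˡ-≤ s (length-subsetsOfSize≤ q W (∈-vertexSets⁻ W∈)))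

  sparse-sized : ∀ {F} → LargeEdge q r J Q F → length F ≡ s → ∣ VF F ∣ ≤ s * (q ∸ r) + r
  sparse-sized {F} large size≡s = subst (λ m → ∣ VF F ∣ ≤ m * (q ∸ r) + r) size≡s (sparse large)

  module _ (∣Q∣≡q : ∣ Q ∣ ≡ q) (r≤q : r ≤ q) (1≤s : 1 ≤ s) where

    hull-between : ∀ {W v} → Q ⊆ₛ W → v ∈ₛ W → v ∉ₛ Q →
      ∣ W ∣ ≤ s * (q ∸ r) + r → ∃ λ X → X ∈ hulls × X ⊆ₛ W × W ⊆ₛ X ∪ ⁅ v ⁆
    hull-between {W} {v} Q⊆W v∈W v∉Q ∣W∣≤
      with xs , length-xs , rest⊆xs , xs⊆rest∪v
             ← padded-elements ((W ─ Q) - v) v (∣W─Q-v∣≤padding ∣Q∣≡q r≤q 1≤s Q⊆W v∈W v∉Q ∣W∣≤)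
      = hull xs , X∈hulls , X⊆W , p─q-x⊆r⇒p⊆q∪r∪⁅x⁆ rest⊆xs
      where
      ⁅v⁆⊆W : ⁅ v ⁆ ⊆ₛ W
      ⁅v⁆⊆W y∈⁅v⁆ = subst (_∈ₛ W) (sym (x∈⁅y⁆⇒x≡y v y∈⁅v⁆)) v∈W
      X⊆W : hull xs ⊆ₛ W
      X⊆W = p⊆r∧q⊆r⇒p∪q⊆r Q⊆W (⊆-trans xs⊆rest∪v (p⊆r∧q⊆r⇒p∪q⊆r (⊆-trans (p─q⊆p _ _) (p─q⊆p W Q)) ⁅v⁆⊆W))
      X∈hulls : hull xs ∈ hulls
      X∈hulls = ∈-small⁺ (∈-map⁺ hull (∈-tuples⁺ {ys = xs} length-xs (λ {x} _ → ∈-allFin x)))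
                         (≤-trans (p⊆q⇒∣p∣≤∣q∣ X⊆W) (≤-trans ∣W∣≤ (sparse-size≤ 1≤s r≤q)))

    VF∈vertexSets : ∀ {F} → LargeEdge q r J Q F → length F ≡ s → VF F ∈ vertexSets
    VF∈vertexSets {F} large size≡s
      -- v need not be listed: S is recovered from S - v ⊆ X and the codegree bound Δ.
      with v , v∈S , v∉Q ← p⊈q⇒∃∈p∉q (edge⊈Q large)
      with X , X∈hulls , X⊆W , W⊆X∪v
             ← hull-between (Q⊆VF large) (edge⊆VF large v∈S) v∉Q (sparse-sized large size≡s)
      = ∈-small⁺ (∈-concatMap⁺′ extensions X∈hulls W∈extensions) (≤-trans (sparse-sized large size≡s) (sparse-size≤ 1≤s r≤q))
      where
      W = VF F
      S = edge large
      ∣S-v∣≡ : ∣ S - v ∣ ≡ r ∸ 1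
      ∣S-v∣≡ = cong (_∸ 1) (trans (x∈p⇒suc∣p-x∣≡∣p∣ v∈S) (∣edge∣≡r large))
      S-v∈ : S - v ∈ subsetsOfSize (r ∸ 1) X
      S-v∈ = subst (λ k → S - v ∈ subsetsOfSize k X) ∣S-v∣≡ (∈-subsetsOfSize⁺ (p⊆q∪⁅x⁆⇒p-x⊆q (W⊆X∪v ∘ edge⊆VF large)))
      S∈ : S ∈ edgesThrough J (S - v)
      S∈ = ∈-filter⁺ (λ S′ → T? (J S′ ∧ ((S - v) ⊆ᵇ S′))) (∈-subsets S)
                     (Equivalence.from T-∧ (edge∈J large , T-does⁺ (S - v ⊆? S) (p─q⊆p S ⁅ v ⁆)))
      W⊆X∪S : W ⊆ₛ X ∪ S
      W⊆X∪S x∈W with x∈p∪q⁻ X ⁅ v ⁆ (W⊆X∪v x∈W)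
      ... | inj₁ x∈X   = x∈p∪q⁺ (inj₁ x∈X)
      ... | inj₂ x∈⁅v⁆ = x∈p∪q⁺ (inj₂ (subst (_∈ₛ S) (sym (x∈⁅y⁆⇒x≡y v x∈⁅v⁆)) v∈S))
      W∈extensions : W ∈ extensions X
      W∈extensions = subst (_∈ extensions X) (⊆-antisym (p⊆r∧q⊆r⇒p∪q⊆r X⊆W (edge⊆VF large)) W⊆X∪S)
                           (∈-concatMap⁺′ _ S-v∈ (∈-map⁺ (X ∪_) S∈))

    large⇒candidate : ∀ {F} → LargeEdge q r J Q F → length F ≡ s → F ∈ candidates
    large⇒candidate {F} large size≡s =
      ∈-concatMap⁺′ _ (VF∈vertexSets large size≡s) (∈-tuples⁺ size≡s F⊆qSubsets)
      where
      F⊆qSubsets : F ⊆ subsetsOfSize q (VF F)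
      F⊆qSubsets {D} D∈F = subst (λ k → D ∈ subsetsOfSize k (VF F)) (clique-size large D∈F)
                                  (∈-subsetsOfSize⁺ (p∈ps⇒p⊆VF D∈F))

length-LargeS≤ : ∀ {n} q r g J (Q : Subset n) s → ∣ Q ∣ ≡ q → r ≤ q → 1 ≤ s →
  length (LargeS n q r g J Q s)
    ≤ n ^ padding q r s * (((s * q) C (r ∸ 1)) * Δ n r J) * ((s * q) C q) ^ s
length-LargeS≤ {n} q r g J Q s ∣Q∣≡q r≤q 1≤s =
  ≤-trans (Unique-⊆⇒length≤ (Unique-LargeS n q r g J Q s) LargeS⊆candidates) length-candidates≤
  where
  open Encoding q r s Q J
  LargeS⊆candidates : LargeS n q r g J Q s ⊆ candidates
  LargeS⊆candidates F∈ = let size≡s , large = ∈LargeS⇒ F∈ in large⇒candidate ∣Q∣≡q r≤q 1≤s large size≡s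

mainTheorem10 : (q r g n : ℕ) → r < q → 2 ≤ r → 3 ≤ g → 1 ≤ n →
    (Q : Subset n) → ∣ Q ∣ ≡ q →
    (J : Subset n → Bool) → (∀ S → J S ≡ true → ∣ S ∣ ≡ r) →
    (s : ℕ) → 1 ≤ s →
    length (LargeS n q r g J Q s) * n
      ≤ (s * q) * ((s * q) C (r ∸ 1)) * (((s * q) C q) ^ s)
          * (n ^ ((q ∸ r) * (s ∸ 1))) * Δ n r J
-- The bound holds without r ≥ 2, g ≥ 3, n ≥ 1 or the r-uniformity of J.
mainTheorem10 q r g n r<q _ _ _ Q ∣Q∣≡q J _ s 1≤s =
  length-*-≤-if-inhabited (LargeS n q r g J Q s) ∈LargeS⇒3≤s λ 3≤s →
    rescale-bound (1≤[q∸r][s∸1] 3≤s) 1≤s*q (length-LargeS≤ q r g J Q s ∣Q∣≡q (<⇒≤ r<q) 1≤s)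
  where
  1≤[q∸r][s∸1] : 3 ≤ s → 1 ≤ (q ∸ r) * (s ∸ 1)
  1≤[q∸r][s∸1] 3≤s = *-mono-≤ (m<n⇒0<n∸m r<q) (∸-monoˡ-≤ 1 (≤-trans (s≤s (s≤s z≤n)) 3≤s))
  1≤s*q : 1 ≤ s * q
  1≤s*q = *-mono-≤ 1≤s (≤-trans (s≤s z≤n) r<q)
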